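{- Let $d$ be a Dyck path of semilength $n$ and let $k = 2n - 1 - \mathrm{lpk}(d)$, where $\mathrm{lpk}(d)$ is the number of low peaks of $d$. Then for every $i \in \{0,1,\ldots,k\}$ we have $[t^i]C_d(t) = [t^{k-i}]C_d(t)$; that is, $C_d(t)$ is palindromic with respect to degree $k$.
   Context: A Dyck path of semilength $n$ is a lattice path from $(0,0)$ to $(2n,0)$ with steps $U=(1,1)$ and $D=(1,-1)$ never going below the $x$-axis. A peak is an occurrence of $UD$ (consecutive up-step then down-step); a low peak is a peak whose steps touch the $x$-axis (i.e. the peak goes from height $0$ to $1$ and back to $0$). For $\sigma = \sigma_1\cdots\sigma_n \in \mathfrak{S}_n$, the canon permutation $\mathrm{can}(d,\sigma)$ is the word of length $2n$ obtained by labeling the $i$-th up-step of $d$ and the $i$-th down-step of $d$ both with $\sigma_i$ (for each $i$), and reading the labels of all $2n$ steps from left to right. For a word $\pi=\pi_1\cdots\pi_{k}$, a descent is an index $j\in[k-1]$ with $\pi_j>\pi_{j+1}$, and $\mathrm{des}(\pi)$ is the number of descents. Write $\mathrm{des}(d,\sigma)=\mathrm{des}(\mathrm{can}(d,\sigma))$. The canon descent polynomial of $d$ is $C_d(t)=\sum_{\sigma\in\mathfrak{S}_n} t^{\mathrm{des}(d,\sigma)}$. $[t^i]f(t)$ denotes the coefficient of $t^i$ in $f$. -}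

module Defs where

open import Data.Nat using (ℕ; zero; suc; _+_; _*_; _∸_; _<ᵇ_; _≡ᵇ_)
open import Data.Bool using (Bool; true; false; _∧_; not; if_then_else_)
open import Data.List using (List; []; _∷_; length; map; filter; concatMap; lookup)
open import Data.Fin using (Fin; toℕ)
open import Data.List using (allFin)
open import Data.Vec using (Vec; []; _∷_; toList)
open import Relation.Binary.PropositionalEquality using (_≡_)

data Step : Set where
  U D : Step

dyckFrom : ℕ → List Step → Bool
dyckFrom zero    []       = true
dyckFrom (suc _) []       = false
dyckFrom h       (U ∷ s)  = dyckFrom (suc h) s
dyckFrom zero    (D ∷ s)  = false
dyckFrom (suc h) (D ∷ s)  = dyckFrom h s

IsDyck : ℕ → List Step → Set
IsDyck n d = (length d ≡ 2 * n) × (dyckFrom 0 d ≡ true)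
  where open import Data.Product using (_×_)

lpkFrom : ℕ → List Step → ℕ
lpkFrom h       []            = 0
lpkFrom zero    (U ∷ D ∷ s)   = suc (lpkFrom zero s)
lpkFrom h       (U ∷ s)       = lpkFrom (suc h) s
lpkFrom zero    (D ∷ s)       = lpkFrom zero s   -- does not occur on Dyck paths
lpkFrom (suc h) (D ∷ s)       = lpkFrom h s

lpk : List Step → ℕ
lpk d = lpkFrom 0 d

-- safe indexing into a list of naturals (default 0, never used on Dyck paths)
nth : List ℕ → ℕ → ℕ
nth []       _       = 0
nth (x ∷ _)  zero    = x
nth (_ ∷ xs) (suc i) = nth xs i

-- canon word: the i-th up-step and the i-th down-step both get label σ_i
-- (u, v = number of up-, down-steps read so far).
canonFrom : List ℕ → ℕ → ℕ → List Step → List ℕ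
canonFrom σ u v []      = []
canonFrom σ u v (U ∷ s) = nth σ u ∷ canonFrom σ (suc u) v s
canonFrom σ u v (D ∷ s) = nth σ v ∷ canonFrom σ u (suc v) s

can : ∀ {n} → List Step → Vec (Fin n) n → List ℕ
can d σ = canonFrom (map toℕ (toList σ)) 0 0 d

des : List ℕ → ℕ
des []           = 0
des (x ∷ [])     = 0
des (x ∷ y ∷ w)  = (if y <ᵇ x then 1 else 0) + des (y ∷ w)

elemᵇ : ℕ → List ℕ → Bool
elemᵇ x []       = false
elemᵇ x (y ∷ ys) = if x ≡ᵇ y then true else elemᵇ x ys

distinct : List ℕ → Bool
distinct []       = true
distinct (x ∷ xs) = not (elemᵇ x xs) ∧ distinct xs

isPerm : ∀ {n} → Vec (Fin n) n → Bool
isPerm σ = distinct (map toℕ (toList σ))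

words : (n m : ℕ) → List (Vec (Fin n) m)
words n zero    = [] ∷ []
words n (suc m) = concatMap (λ x → map (x ∷_) (words n m)) (allFin n)

-- [t^i] C_d(t) = #{ σ ∈ S_n : des(can(d,σ)) = i }
canonCoeff : (n : ℕ) → List Step → ℕ → ℕ
canonCoeff n d i =
  length (filter (λ σ → T? (isPerm σ ∧ (des (can d σ) ≡ᵇ i))) (words n n))
  where
  open import Data.Bool using (T)
  open import Relation.Nullary.Decidable using (Dec)
  open import Data.Bool.Properties using (T?)

module Submission where

-- Complementing letters, σᵢ ↦ n + 1 − σᵢ, is an involution of 𝔖ₙ, and can(d, σ̄) is the
-- letterwise complement of can(d, σ). Each of the 2n − 1 adjacent pairs of a word is an
-- ascent, a descent or a tie, and complementation exchanges ascents with descents, so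
-- des(d, σ̄) + des(d, σ) + #ties = 2n − 1. In a canon word two adjacent letters can only tie
-- when they label the j-th up-step followed directly by the j-th down-step, since σ is
-- injective; that happens exactly at the low peaks. Hence des(d, σ̄) = k − des(d, σ), and
-- σ ↦ σ̄ carries the permutations counted by [tⁱ]C_d onto those counted by [t^(k−i)]C_d.

open import Defs
open import Data.Nat using (ℕ; zero; suc; _+_; _*_; _∸_; _≤_; _<_; _<ᵇ_; _≡ᵇ_; s≤s; s<s⁻¹)
open import Data.Nat.Properties
open import Data.Nat.Tactic.RingSolver using (solve-∀)
open import Data.Bool using (Bool; true; false; T; not; _∧_; if_then_else_)
open import Data.Empty using (⊥-elim)
open import Data.Unit using (tt)
open import Data.Product using (_×_; _,_; proj₁; proj₂)
open import Data.List using (List; []; _∷_; _∷ʳ_; map; length; filterᵇ; concatMap; tabulate; allFin)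
open import Data.List.Properties
  using (map-∘; map-cong; map-cong-local; length-map; map-concatMap; concatMap-map; map-tabulate)
open import Data.List.Relation.Unary.All using (All; []; _∷_; universal)
import Data.List.Relation.Unary.All as All
open import Data.List.Relation.Unary.All.Properties using () renaming (map⁺ to All-map⁺)
open import Data.List.Relation.Binary.Permutation.Propositional
  using (_↭_; ↭-refl; ↭-trans; module PermutationReasoning)
import Data.List.Relation.Binary.Permutation.Propositional as ↭
open import Data.List.Relation.Binary.Permutation.Propositional.Properties
  using (↭-length; filter-↭; map⁺; ++⁺; ++⁺ˡ; shifts; ∷↭∷ʳ)
open import Data.Fin using (Fin; toℕ; opposite; fromℕ; inject₁) renaming (zero to fzero; suc to fsuc)
open import Data.Fin.Properties using (opposite-prop; toℕ<n)
open import Data.Vec using (Vec; toList)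
import Data.Vec as Vec
open import Data.Vec.Properties using (toList-map; length-toList)
open import Function using (_∘_; id)
open import Relation.Binary.PropositionalEquality
  using (_≡_; _≢_; ≢-sym; refl; sym; trans; cong; cong₂; subst; module ≡-Reasoning)

private variable
  A B : Set

T-injective : {x y : Bool} → (T x → T y) → (T y → T x) → x ≡ y
T-injective {false} {false} _  _    = refl
T-injective {true}  {true}  _  _    = refl
T-injective {true}  {false} to _    = ⊥-elim (to tt)
T-injective {false} {true}  _  from = ⊥-elim (from tt)

≡ᵇ-cong : ∀ {a b c d} → (a ≡ b → c ≡ d) → (c ≡ d → a ≡ b) → (a ≡ᵇ b) ≡ (c ≡ᵇ d)
≡ᵇ-cong {a} {b} {c} {d} to from =
  T-injective (≡⇒≡ᵇ c d ∘ to ∘ ≡ᵇ⇒≡ a b) (≡⇒≡ᵇ a b ∘ from ∘ ≡ᵇ⇒≡ c d)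

<ᵇ-cong : ∀ {a b c d} → (a < b → c < d) → (c < d → a < b) → (a <ᵇ b) ≡ (c <ᵇ d)
<ᵇ-cong {a} {b} {c} {d} to from = T-injective (<⇒<ᵇ ∘ to ∘ <ᵇ⇒< a b) (<⇒<ᵇ ∘ from ∘ <ᵇ⇒< c d)

≡ᵇ-refl : ∀ n → (n ≡ᵇ n) ≡ true
≡ᵇ-refl zero    = refl
≡ᵇ-refl (suc n) = ≡ᵇ-refl n

≢⇒≡ᵇ≡false : ∀ {m n} → m ≢ n → (m ≡ᵇ n) ≡ false
≢⇒≡ᵇ≡false {m} {n} m≢n = T-injective (m≢n ∘ ≡ᵇ⇒≡ m n) λ ()

plateaus : List ℕ → ℕ
plateaus []          = 0
plateaus (x ∷ [])    = 0
plateaus (x ∷ y ∷ w) = (if x ≡ᵇ y then 1 else 0) + plateaus (y ∷ w)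

indicator-false : ∀ {b r} → b ≡ false → (if b then 1 else 0) + r ≡ r
indicator-false refl = refl

indicator-true : ∀ {b r} → b ≡ true → (if b then 1 else 0) + r ≡ suc r
indicator-true refl = refl

<ᵇ-trichotomy : ∀ x y →
  (if x <ᵇ y then 1 else 0) + (if y <ᵇ x then 1 else 0) + (if x ≡ᵇ y then 1 else 0) ≡ 1
<ᵇ-trichotomy zero    zero    = refl
<ᵇ-trichotomy zero    (suc y) = refl
<ᵇ-trichotomy (suc x) zero    = refl
<ᵇ-trichotomy (suc x) (suc y) = <ᵇ-trichotomy x y

complement : ℕ → ℕ → ℕ
complement n x = n ∸ suc x

complement-<ᵇ : ∀ {n x y} → y < n → (complement n y <ᵇ complement n x) ≡ (x <ᵇ y)
complement-<ᵇ {n} y<n = <ᵇ-cong (s<s⁻¹ ∘ ∸-cancelʳ-< {o = n}) (λ x<y → ∸-monoʳ-< (s≤s x<y) y<n)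

private
  +-interchange₃ : ∀ a b c x y z → (a + x) + (b + y) + (c + z) ≡ (a + b + c) + (x + y + z)
  +-interchange₃ = solve-∀

des-complement : ∀ {n w} → All (_< n) w →
  des (map (complement n) w) + des w + plateaus w ≡ length w ∸ 1
des-complement []           = refl
des-complement (_ ∷ [])     = refl
des-complement {n} {x ∷ y ∷ w} (_ ∷ y<n ∷ bounded) = begin
  (a + des (map (complement n) (y ∷ w))) + (b + des (y ∷ w)) + (c + plateaus (y ∷ w))
    ≡⟨ +-interchange₃ a b c _ _ _ ⟩
  (a + b + c) + (des (map (complement n) (y ∷ w)) + des (y ∷ w) + plateaus (y ∷ w))
    ≡⟨ cong₂ _+_ exactlyOne (des-complement (y<n ∷ bounded)) ⟩
  suc (length w)
    ∎
  where
  open ≡-Reasoning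
  a b c : ℕ
  a = if complement n y <ᵇ complement n x then 1 else 0
  b = if y <ᵇ x then 1 else 0
  c = if x ≡ᵇ y then 1 else 0
  exactlyOne : a + b + c ≡ 1
  exactlyOne = trans (cong (λ β → (if β then 1 else 0) + b + c) (complement-<ᵇ y<n)) (<ᵇ-trichotomy x y)

InjectiveOn : (ℕ → Set) → (ℕ → ℕ) → Set
InjectiveOn P f = ∀ {x y} → P x → P y → f x ≡ f y → x ≡ y

module _ {P : ℕ → Set} {f : ℕ → ℕ} (injective : InjectiveOn P f) where

  ≡ᵇ-map : ∀ {x y} → P x → P y → (f x ≡ᵇ f y) ≡ (x ≡ᵇ y)
  ≡ᵇ-map px py = ≡ᵇ-cong (injective px py) (cong f)

  plateaus-map : ∀ {w} → All P w → plateaus (map f w) ≡ plateaus w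
  plateaus-map []                 = refl
  plateaus-map (_ ∷ [])           = refl
  plateaus-map (px ∷ py ∷ bounded) =
    cong₂ _+_ (cong (λ β → if β then 1 else 0) (≡ᵇ-map px py)) (plateaus-map (py ∷ bounded))

  elemᵇ-map : ∀ {x ys} → P x → All P ys → elemᵇ (f x) (map f ys) ≡ elemᵇ x ys
  elemᵇ-map px []         = refl
  elemᵇ-map px (py ∷ pys) =
    cong₂ (λ β r → if β then true else r) (≡ᵇ-map px py) (elemᵇ-map px pys)

  distinct-map : ∀ {xs} → All P xs → distinct (map f xs) ≡ distinct xs
  distinct-map []         = refl
  distinct-map (px ∷ pxs) = cong₂ (λ β r → not β ∧ r) (elemᵇ-map px pxs) (distinct-map pxs)

complement-injective : ∀ {n} → InjectiveOn (_< n) (complement n)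
complement-injective x<n y<n eq = suc-injective (∸-cancelˡ-≡ x<n y<n eq)

distinct-∷ : ∀ x xs → distinct (x ∷ xs) ≡ true → elemᵇ x xs ≢ true × distinct xs ≡ true
distinct-∷ x xs dist with elemᵇ x xs | distinct xs
... | false | true = (λ ()) , refl

elemᵇ-nth : ∀ xs {j} → j < length xs → elemᵇ (nth xs j) xs ≡ true
elemᵇ-nth (x ∷ xs) {zero}  _ rewrite ≡ᵇ-refl x = refl
elemᵇ-nth (x ∷ xs) {suc j} (s≤s j<n) with nth xs j ≡ᵇ x
... | true  = refl
... | false = elemᵇ-nth xs j<n

nth-injective : ∀ xs → distinct xs ≡ true → InjectiveOn (_< length xs) (nth xs)
nth-injective (x ∷ xs) dist {zero}  {zero}  _         _         _  = refl
nth-injective (x ∷ xs) dist {zero}  {suc j} _         (s≤s j<n) eq =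
  ⊥-elim (proj₁ (distinct-∷ x xs dist) (subst (λ z → elemᵇ z xs ≡ true) (sym eq) (elemᵇ-nth xs j<n)))
nth-injective (x ∷ xs) dist {suc i} {zero}  (s≤s i<n) _         eq =
  ⊥-elim (proj₁ (distinct-∷ x xs dist) (subst (λ z → elemᵇ z xs ≡ true) eq (elemᵇ-nth xs i<n)))
nth-injective (x ∷ xs) dist {suc i} {suc j} (s≤s i<n) (s≤s j<n) eq =
  cong suc (nth-injective xs (proj₂ (distinct-∷ x xs dist)) i<n j<n eq)

ups : List Step → ℕ
ups []      = 0
ups (U ∷ s) = suc (ups s)
ups (D ∷ s) = ups s

downs : List Step → ℕ
downs []      = 0
downs (U ∷ s) = downs s
downs (D ∷ s) = suc (downs s)

length≡ups+downs : ∀ s → length s ≡ ups s + downs s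
length≡ups+downs []      = refl
length≡ups+downs (U ∷ s) = cong suc (length≡ups+downs s)
length≡ups+downs (D ∷ s) = trans (cong suc (length≡ups+downs s)) (sym (+-suc (ups s) (downs s)))

dyckFrom⇒downs≡h+ups : ∀ h s → dyckFrom h s ≡ true → downs s ≡ h + ups s
dyckFrom⇒downs≡h+ups zero    []      _  = refl
dyckFrom⇒downs≡h+ups zero    (U ∷ s) dy = dyckFrom⇒downs≡h+ups 1 s dy
dyckFrom⇒downs≡h+ups (suc h) (U ∷ s) dy =
  trans (dyckFrom⇒downs≡h+ups (suc (suc h)) s dy) (cong suc (sym (+-suc h (ups s))))
dyckFrom⇒downs≡h+ups (suc h) (D ∷ s) dy = cong suc (dyckFrom⇒downs≡h+ups h s dy)

dyck-ups : ∀ {n} d → IsDyck n d → ups d ≡ n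
dyck-ups {n} d (len , dy) = *-cancelˡ-≡ (ups d) n 2 (begin
  ups d + (ups d + 0) ≡⟨ cong (ups d +_) (+-identityʳ (ups d)) ⟩
  ups d + ups d       ≡⟨ cong (ups d +_) (dyckFrom⇒downs≡h+ups 0 d dy) ⟨
  ups d + downs d     ≡⟨ length≡ups+downs d ⟨
  length d            ≡⟨ len ⟩
  2 * n               ∎)
  where open ≡-Reasoning

dyck-downs : ∀ {n} d → IsDyck n d → downs d ≡ n
dyck-downs d isDyck@(_ , dy) = trans (dyckFrom⇒downs≡h+ups 0 d dy) (dyck-ups d isDyck)

canonIndices : ℕ → ℕ → List Step → List ℕ
canonIndices u v []      = []
canonIndices u v (U ∷ s) = u ∷ canonIndices (suc u) v s
canonIndices u v (D ∷ s) = v ∷ canonIndices u (suc v) s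

canonFrom≡map-nth : ∀ σ {u v} s → canonFrom σ u v s ≡ map (nth σ) (canonIndices u v s)
canonFrom≡map-nth σ []      = refl
canonFrom≡map-nth σ (U ∷ s) = cong (_ ∷_) (canonFrom≡map-nth σ s)
canonFrom≡map-nth σ (D ∷ s) = cong (_ ∷_) (canonFrom≡map-nth σ s)

canonIndices-< : ∀ {L u v} s → ups s + u ≤ L → downs s + v ≤ L → All (_< L) (canonIndices u v s)
canonIndices-< []      _  _  = []
canonIndices-< {u = u} (U ∷ s) bu bd =
  ≤-trans (s≤s (m≤n+m u (ups s))) bu
    ∷ canonIndices-< s (≤-trans (≤-reflexive (+-suc (ups s) u)) bu) bd
canonIndices-< {v = v} (D ∷ s) bu bd =
  ≤-trans (s≤s (m≤n+m v (downs s))) bd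
    ∷ canonIndices-< s bu (≤-trans (≤-reflexive (+-suc (downs s) v)) bd)

dyck-canonIndices-< : ∀ {n} d → IsDyck n d → All (_< n) (canonIndices 0 0 d)
dyck-canonIndices-< d isDyck =
  canonIndices-< d (≤-reflexive (trans (+-identityʳ (ups d)) (dyck-ups d isDyck)))
                   (≤-reflexive (trans (+-identityʳ (downs d)) (dyck-downs d isDyck)))

-- An up-step read at height h gets index h + v, where v indexes the next down-step, so
-- two adjacent steps share an index exactly at a peak of height 0.
plateaus-canonIndices : ∀ {u v h} s → u ≡ h + v → dyckFrom h s ≡ true →
                        plateaus (canonIndices u v s) ≡ lpkFrom h s
plateaus-canonIndices []                   _    _  = refl
plateaus-canonIndices {h = zero}  (U ∷ []) _    ()
plateaus-canonIndices {h = suc _} (U ∷ []) _    ()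
plateaus-canonIndices {h = zero}  (D ∷ _)  _    ()
plateaus-canonIndices {h = suc _} (D ∷ []) _    _  = refl
plateaus-canonIndices {v = v} {h = zero} (U ∷ U ∷ s) refl dy =
  trans (indicator-false (≢⇒≡ᵇ≡false {v} (≢-sym 1+n≢n)))
        (plateaus-canonIndices (U ∷ s) refl dy)
plateaus-canonIndices {v = v} {h = suc h} (U ∷ U ∷ s) refl dy =
  trans (indicator-false (≢⇒≡ᵇ≡false {suc (h + v)} (≢-sym 1+n≢n)))
        (plateaus-canonIndices (U ∷ s) refl dy)
plateaus-canonIndices {v = v} {h = zero} (U ∷ D ∷ s) refl dy =
  trans (indicator-true (≡ᵇ-refl v))
        (cong suc (plateaus-canonIndices (D ∷ s) refl dy))
plateaus-canonIndices {v = v} {h = suc h} (U ∷ D ∷ s) refl dy =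
  trans (indicator-false (≢⇒≡ᵇ≡false {suc (h + v)} (≢-sym (m≢1+n+m v))))
        (plateaus-canonIndices (D ∷ s) refl dy)
plateaus-canonIndices {v = v} {h = suc h} (D ∷ U ∷ s) refl dy =
  trans (indicator-false (≢⇒≡ᵇ≡false {v} (m≢1+n+m v)))
        (plateaus-canonIndices (U ∷ s) (sym (+-suc h v)) dy)
plateaus-canonIndices {v = v} {h = suc h} (D ∷ D ∷ s) refl dy =
  trans (indicator-false (≢⇒≡ᵇ≡false {v} (≢-sym 1+n≢n)))
        (plateaus-canonIndices (D ∷ s) (sym (+-suc h v)) dy)

nth-map : ∀ (f : ℕ → ℕ) σ {j} → j < length σ → nth (map f σ) j ≡ f (nth σ j)
nth-map f (x ∷ σ) {zero}  _         = refl
nth-map f (x ∷ σ) {suc j} (s≤s j<n) = nth-map f σ j<n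

nth-All : ∀ {P : ℕ → Set} {σ} → All P σ → ∀ {j} → j < length σ → P (nth σ j)
nth-All (px ∷ _)   {zero}  _         = px
nth-All (_  ∷ pσ) {suc j} (s≤s j<n) = nth-All pσ j<n

module _ (σ : List ℕ) {u v : ℕ} (s : List Step)
         (bounds : All (_< length σ) (canonIndices u v s)) where

  canonFrom-map : ∀ f → canonFrom (map f σ) u v s ≡ map f (canonFrom σ u v s)
  canonFrom-map f = begin
    canonFrom (map f σ) u v s                 ≡⟨ canonFrom≡map-nth (map f σ) s ⟩
    map (nth (map f σ)) (canonIndices u v s)  ≡⟨ map-cong-local (All.map (nth-map f σ) bounds) ⟩
    map (f ∘ nth σ) (canonIndices u v s)      ≡⟨ map-∘ (canonIndices u v s) ⟩
    map f (map (nth σ) (canonIndices u v s))  ≡⟨ cong (map f) (canonFrom≡map-nth σ s) ⟨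
    map f (canonFrom σ u v s)                 ∎
    where open ≡-Reasoning

  canonFrom-All : ∀ {P : ℕ → Set} → All P σ → All P (canonFrom σ u v s)
  canonFrom-All pσ = subst (All _) (sym (canonFrom≡map-nth σ s)) (All-map⁺ (All.map (nth-All pσ) bounds))

length-canonFrom : ∀ σ {u v} s → length (canonFrom σ u v s) ≡ length s
length-canonFrom σ []      = refl
length-canonFrom σ (U ∷ s) = cong suc (length-canonFrom σ s)
length-canonFrom σ (D ∷ s) = cong suc (length-canonFrom σ s)

plateaus-canonFrom : ∀ σ d → distinct σ ≡ true → IsDyck (length σ) d →
                     plateaus (canonFrom σ 0 0 d) ≡ lpk d
plateaus-canonFrom σ d dist isDyck@(_ , dy) = begin
  plateaus (canonFrom σ 0 0 d)                ≡⟨ cong plateaus (canonFrom≡map-nth σ d) ⟩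
  plateaus (map (nth σ) (canonIndices 0 0 d)) ≡⟨ plateaus-map (nth-injective σ dist)
                                                                (dyck-canonIndices-< d isDyck) ⟩
  plateaus (canonIndices 0 0 d)               ≡⟨ plateaus-canonIndices d refl dy ⟩
  lpk d                                       ∎
  where open ≡-Reasoning

labels : ∀ {n m} → Vec (Fin n) m → List ℕ
labels σ = map toℕ (toList σ)

length-labels : ∀ {n m} (σ : Vec (Fin n) m) → length (labels σ) ≡ m
length-labels σ = trans (length-map toℕ (toList σ)) (length-toList σ)

labels-< : ∀ {n m} (σ : Vec (Fin n) m) → All (_< n) (labels σ)
labels-< σ = All-map⁺ (universal toℕ<n (toList σ))

labels-opposite : ∀ {n m} (σ : Vec (Fin n) m) →
                  labels (Vec.map opposite σ) ≡ map (complement n) (labels σ)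
labels-opposite {n} σ = begin
  map toℕ (toList (Vec.map opposite σ)) ≡⟨ cong (map toℕ) (toList-map opposite σ) ⟩
  map toℕ (map opposite (toList σ))     ≡⟨ map-∘ (toList σ) ⟨
  map (toℕ ∘ opposite) (toList σ)       ≡⟨ map-cong opposite-prop (toList σ) ⟩
  map (complement n ∘ toℕ) (toList σ)   ≡⟨ map-∘ (toList σ) ⟩
  map (complement n) (labels σ)         ∎
  where open ≡-Reasoning

isPerm-opposite : ∀ {n} (σ : Vec (Fin n) n) → isPerm (Vec.map opposite σ) ≡ isPerm σ
isPerm-opposite σ =
  trans (cong distinct (labels-opposite σ)) (distinct-map complement-injective (labels-< σ))

des-canon-opposite : ∀ {n} d → IsDyck n d → (σ : Vec (Fin n) n) → isPerm σ ≡ true →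
  des (can d (Vec.map opposite σ)) + des (can d σ) ≡ 2 * n ∸ 1 ∸ lpk d
des-canon-opposite {n} d isDyck σ perm = begin
  des (canonFrom (labels (Vec.map opposite σ)) 0 0 d) + des w
    ≡⟨ cong (λ ℓ → des (canonFrom ℓ 0 0 d) + des w) (labels-opposite σ) ⟩
  des (canonFrom (map (complement n) (labels σ)) 0 0 d) + des w
    ≡⟨ cong (λ w′ → des w′ + des w) (canonFrom-map (labels σ) d bounds (complement n)) ⟩
  des (map (complement n) w) + des w
    ≡⟨ m+n∸n≡m _ (plateaus w) ⟨
  des (map (complement n) w) + des w + plateaus w ∸ plateaus w
    ≡⟨ cong₂ _∸_ (des-complement (canonFrom-All (labels σ) d bounds (labels-< σ)))
                 (plateaus-canonFrom (labels σ) d perm isDyck′) ⟩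
  length w ∸ 1 ∸ lpk d
    ≡⟨ cong (λ ℓ → ℓ ∸ 1 ∸ lpk d) (trans (length-canonFrom (labels σ) d) (proj₁ isDyck)) ⟩
  2 * n ∸ 1 ∸ lpk d
    ∎
  where
  open ≡-Reasoning
  w : List ℕ
  w = can d σ
  isDyck′ : IsDyck (length (labels σ)) d
  isDyck′ = subst (λ m → IsDyck m d) (sym (length-labels σ)) isDyck
  bounds : All (_< length (labels σ)) (canonIndices 0 0 d)
  bounds = dyck-canonIndices-< d isDyck′

concatMap⁺ : ∀ (f : A → List B) {xs ys} → xs ↭ ys → concatMap f xs ↭ concatMap f ys
concatMap⁺ f ↭.refl            = ↭-refl
concatMap⁺ f (↭.prep x p)      = ++⁺ˡ (f x) (concatMap⁺ f p)
concatMap⁺ f (↭.swap x y p)    = ↭-trans (shifts (f x) (f y)) (++⁺ˡ (f y) (++⁺ˡ (f x) (concatMap⁺ f p)))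
concatMap⁺ f (↭.trans p q)     = ↭-trans (concatMap⁺ f p) (concatMap⁺ f q)

concatMap-cong-↭ : ∀ {f g : A → List B} → (∀ x → f x ↭ g x) → ∀ xs → concatMap f xs ↭ concatMap g xs
concatMap-cong-↭ f↭g []       = ↭-refl
concatMap-cong-↭ f↭g (x ∷ xs) = ++⁺ (f↭g x) (concatMap-cong-↭ f↭g xs)

tabulate-∷ʳ : ∀ {n} (f : Fin (suc n) → A) → tabulate f ≡ tabulate (f ∘ inject₁) ∷ʳ f (fromℕ n)
tabulate-∷ʳ {n = zero}  f = refl
tabulate-∷ʳ {n = suc n} f = cong (f fzero ∷_) (tabulate-∷ʳ (f ∘ fsuc))

tabulate-opposite : ∀ {n} (f : Fin n → A) → tabulate (f ∘ opposite) ↭ tabulate f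
tabulate-opposite {n = zero}  f = ↭-refl
tabulate-opposite {n = suc n} f = begin
  f (fromℕ n) ∷ tabulate (f ∘ inject₁ ∘ opposite) ↭⟨ ↭.prep _ (tabulate-opposite (f ∘ inject₁)) ⟩
  f (fromℕ n) ∷ tabulate (f ∘ inject₁)            ↭⟨ ∷↭∷ʳ _ _ ⟩
  tabulate (f ∘ inject₁) ∷ʳ f (fromℕ n)           ≡⟨ tabulate-∷ʳ f ⟨
  tabulate f                                      ∎
  where open PermutationReasoning

words-opposite : ∀ n m → map (Vec.map opposite) (words n m) ↭ words n m
words-opposite n zero    = ↭-refl
words-opposite n (suc m) = begin
  map (Vec.map opposite) (concatMap prefix (allFin n))
    ≡⟨ map-concatMap _ prefix (allFin n) ⟩
  concatMap (map (Vec.map opposite) ∘ prefix) (allFin n)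
    ↭⟨ concatMap-cong-↭ prefix-opposite (allFin n) ⟩
  concatMap (prefix ∘ opposite) (allFin n)
    ≡⟨ concatMap-map prefix opposite (allFin n) ⟨
  concatMap prefix (map opposite (allFin n))
    ≡⟨ cong (concatMap prefix) (map-tabulate id opposite) ⟩
  concatMap prefix (tabulate opposite)
    ↭⟨ concatMap⁺ prefix (tabulate-opposite id) ⟩
  concatMap prefix (allFin n)
    ∎
  where
  open PermutationReasoning
  prefix : Fin n → List (Vec (Fin n) (suc m))
  prefix x = map (x Vec.∷_) (words n m)
  prefix-opposite : ∀ x → map (Vec.map opposite) (prefix x) ↭ prefix (opposite x)
  prefix-opposite x = begin
    map (Vec.map opposite) (map (x Vec.∷_) (words n m))           ≡⟨ map-∘ (words n m) ⟨
    map ((opposite x Vec.∷_) ∘ Vec.map opposite) (words n m)      ≡⟨ map-∘ (words n m) ⟩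
    map (opposite x Vec.∷_) (map (Vec.map opposite) (words n m)) ↭⟨ map⁺ _ (words-opposite n m) ⟩
    prefix (opposite x)                                           ∎

length-filterᵇ-map : ∀ {p : B → Bool} {q : A → Bool} (f : A → B) → (∀ x → p (f x) ≡ q x) →
                     ∀ xs → length (filterᵇ p (map f xs)) ≡ length (filterᵇ q xs)
length-filterᵇ-map f pf≡q []       = refl
length-filterᵇ-map {q = q} f pf≡q (x ∷ xs) rewrite pf≡q x with q x
... | true  = cong suc (length-filterᵇ-map f pf≡q xs)
... | false = length-filterᵇ-map f pf≡q xs

≡ᵇ-complementary : ∀ a b {k i} → a + b ≡ k → i ≤ k → (a ≡ᵇ i) ≡ (b ≡ᵇ k ∸ i)
≡ᵇ-complementary a b {k} {i} a+b≡k i≤k = ≡ᵇ-cong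
  (λ a≡i → begin
     b         ≡⟨ m+n∸m≡n a b ⟨
     a + b ∸ a ≡⟨ cong₂ _∸_ a+b≡k a≡i ⟩
     k ∸ i     ∎)
  (λ b≡k∸i → begin
     a           ≡⟨ m+n∸n≡m a b ⟨
     a + b ∸ b   ≡⟨ cong₂ _∸_ a+b≡k b≡k∸i ⟩
     k ∸ (k ∸ i) ≡⟨ m∸[m∸n]≡n i≤k ⟩
     i           ∎)
  where open ≡-Reasoning

m+n+1≤o⇒m≤o∸1∸n : ∀ m n {o} → m + n + 1 ≤ o → m ≤ o ∸ 1 ∸ n
m+n+1≤o⇒m≤o∸1∸n m n {o} bound =
  subst (m ≤_) (sym (∸-+-assoc o 1 n)) (m+n≤o⇒m≤o∸n m (subst (_≤ o) rearrange bound))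
  where
  rearrange : m + n + 1 ≡ m + (1 + n)
  rearrange = trans (+-assoc m n 1) (cong (m +_) (+-comm n 1))

proposition3p1 : (n : ℕ) (d : List Step) → IsDyck n d →
    (i : ℕ) → i + lpk d + 1 ≤ 2 * n →
    canonCoeff n d i ≡ canonCoeff n d ((2 * n ∸ 1 ∸ lpk d) ∸ i)
proposition3p1 n d isDyck i bound = begin
  canonCoeff n d i
    ≡⟨ ↭-length (filter-↭ _ (words-opposite n n)) ⟨
  length (filterᵇ (hasDes i) (map (Vec.map opposite) (words n n)))
    ≡⟨ length-filterᵇ-map (Vec.map opposite) hasDes-opposite (words n n) ⟩
  canonCoeff n d (k ∸ i)
    ∎
  where
  open ≡-Reasoning
  k : ℕ
  k = 2 * n ∸ 1 ∸ lpk d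
  hasDes : ℕ → Vec (Fin n) n → Bool
  hasDes j σ = isPerm σ ∧ (des (can d σ) ≡ᵇ j)
  hasDes-opposite : ∀ σ → hasDes i (Vec.map opposite σ) ≡ hasDes (k ∸ i) σ
  hasDes-opposite σ rewrite isPerm-opposite σ with isPerm σ in perm
  ... | false = refl
  ... | true  = ≡ᵇ-complementary (des (can d (Vec.map opposite σ))) (des (can d σ))
                  (des-canon-opposite d isDyck σ perm) (m+n+1≤o⇒m≤o∸1∸n i (lpk d) bound)
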